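{- Let $n\ge 4$ be an even integer and let $G$ be a graph of order $m\ge 2$ which is either the path $P_m$ or the complete graph $K_m$. Then $g(G\boxtimes C_n)=4$ and $h(G\boxtimes C_n)=2$.
   Context: $P_m$, $K_m$, $C_n$ denote the path and complete graph of order $m$ and the cycle of order $n$. For a connected graph, $I[x,y]$ consists of $x$, $y$ and all vertices on some shortest $x$–$y$ path; $I[S]=\bigcup_{u,v\in S}I[u,v]$; $S$ is geodetic if $I[S]$ is the whole vertex set and $g(\cdot)$ is the minimum size of a geodetic set. $S$ is convex if $I[S]=S$; $CH(S)$ is the smallest convex set containing $S$; $S$ is a hull set if $CH(S)$ is the whole vertex set, and $h(\cdot)$ is the minimum size of a hull set. The strong product $G\boxtimes H$ has vertex set $V(G)\times V(H)$, with $(g,h)$ and $(g',h')$ adjacent whenever ($g=g'$ and $hh'\in E(H)$), or ($h=h'$ and $gg'\in E(G)$), or ($gg'\in E(G)$ and $hh'\in E(H)$). -}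

module Defs where

open import Level using (Level; _⊔_) renaming (suc to lsuc; zero to lzero)
open import Data.Nat using (ℕ; zero; suc; _≤_; _∸_)
open import Data.Fin using (Fin; toℕ)
open import Data.Product using (Σ; _×_; _,_; ∃)
open import Data.Sum using (_⊎_)
open import Data.List using (List; length)
open import Data.List.Membership.Propositional using (_∈_)
open import Data.List.Relation.Unary.Unique.Propositional using (Unique)
open import Relation.Binary.PropositionalEquality using (_≡_; _≢_)
open import Relation.Nullary using (¬_)

record Graph : Set₁ where
  field
    V   : Set
    Adj : V → V → Set
open Graph public

data Walk (G : Graph) : V G → V G → ℕ → Set where
  [_]  : (x : V G) → Walk G x x zero
  _∷_  : ∀ {x y z k} → Adj G x y → Walk G y z k → Walk G x z (suc k)

data OnWalk (G : Graph) (z : V G) : ∀ {x y k} → Walk G x y k → Set where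
  here-end : OnWalk G z [ z ]
  here     : ∀ {y w k} (e : Adj G z y) (p : Walk G y w k) → OnWalk G z (e ∷ p)
  there    : ∀ {x y w k} (e : Adj G x y) {p : Walk G y w k} → OnWalk G z p → OnWalk G z (e ∷ p)

Shortest : (G : Graph) {x y : V G} {k : ℕ} → Walk G x y k → Set
Shortest G {x} {y} {k} w = ∀ j → Walk G x y j → k ≤ j

Interval : (G : Graph) → V G → V G → V G → Set
Interval G x y z = Σ ℕ λ k → Σ (Walk G x y k) λ w → Shortest G w × OnWalk G z w

Geodetic : (G : Graph) → List (V G) → Set
Geodetic G S = ∀ z → Σ (V G) λ u → Σ (V G) λ v → u ∈ S × v ∈ S × Interval G u v z

GeodeticNumber : Graph → ℕ → Set
GeodeticNumber G k =
  (Σ (List (V G)) λ S → Unique S × length S ≡ k × Geodetic G S)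
  × (∀ (S : List (V G)) → Unique S → Geodetic G S → k ≤ length S)

Convex : (G : Graph) → (V G → Set) → Set
Convex G C = ∀ u v z → C u → C v → Interval G u v z → C z

Hull : (G : Graph) → List (V G) → V G → Set₁
Hull G S x = ∀ (C : V G → Set) → Convex G C → (∀ s → s ∈ S → C s) → C x

HullSet : (G : Graph) → List (V G) → Set₁
HullSet G S = ∀ x → Hull G S x

HullNumber : Graph → ℕ → Set₁
HullNumber G k =
  (Σ (List (V G)) λ S → Unique S × length S ≡ k × HullSet G S)
  × (∀ (S : List (V G)) → Unique S → HullSet G S → k ≤ length S)

pathGraph : ℕ → Graph
pathGraph m = record
  { V = Fin m
  ; Adj = λ i j → toℕ j ≡ suc (toℕ i) ⊎ toℕ i ≡ suc (toℕ j) }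

completeGraph : ℕ → Graph
completeGraph m = record { V = Fin m ; Adj = λ i j → i ≢ j }

-- Cycle C_n on vertices 0,…,n-1 (i ~ i+1, and 0 ~ n-1); intended for n ≥ 3
cycleGraph : ℕ → Graph
cycleGraph n = record
  { V = Fin n
  ; Adj = λ i j → toℕ j ≡ suc (toℕ i) ⊎ toℕ i ≡ suc (toℕ j)
                  ⊎ (toℕ i ≡ 0 × toℕ j ≡ n ∸ 1) ⊎ (toℕ j ≡ 0 × toℕ i ≡ n ∸ 1) }

_⊠_ : Graph → Graph → Graph
G ⊠ H = record
  { V = V G × V H
  ; Adj = λ { (g , h) (g' , h') →
        (g ≡ g' × Adj H h h') ⊎ (h ≡ h' × Adj G g g') ⊎ (Adj G g g' × Adj H h h') } }

module Submission where

-- The argument works with distances rather than walks.  A graph metric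
-- (record Metric) is a distance realised by walks and changing by at most
-- one along an edge; for it, z ∈ I[u,v] iff d u z + d z v ≤ d u v.  The
-- strong product carries the maximum of the factor metrics, and P_m, K_m
-- and C_n carry explicit metrics.  P_m and K_m have "poles" (record Poles):
-- two distinct extreme vertices c₀, c₁ such that every vertex lies on a
-- c₀–c₁ geodesic or is within distance one of both.
--
-- Lower bounds hold in general: a single vertex is convex, so h ≥ 2; and if
-- G has two distinct extreme vertices and H two vertices, g(G ⊠ H) ≥ 4
-- (module GeodeticLowerBound).  Upper bounds use the cycle C_(2h): the
-- antipodal pairs (0, h) and (1, h + 1) have every height on a geodesic
-- between them, which makes {(c₀,0), (c₀,h), (c₁,1), (c₁,h+1)} geodetic and
-- {(c₀,0), (c₀,h)} a hull set (module EvenCycleProduct).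


open import Defs
open import Data.Nat using (ℕ; zero; suc; _≤_; _<_; _+_; _*_; _∸_; _⊔_; _⊓_; z≤n; s≤s; ∣_-_∣; _≤?_; _≟_)
open import Data.Nat.Properties
open import Data.Nat.Divisibility using (_∣_; divides)
open import Data.Fin using (Fin; toℕ; fromℕ; fromℕ<) renaming (zero to fzero; suc to fsuc; _<_ to _<F_)
open import Data.Fin.Properties using (toℕ-injective; toℕ<n; toℕ-fromℕ; toℕ-fromℕ<; pigeonhole) renaming (_≟_ to _≟F_)
open import Data.Product using (Σ; _×_; _,_; proj₁; proj₂)
open import Data.Sum using (_⊎_; inj₁; inj₂)
open import Data.Empty using (⊥; ⊥-elim)
open import Data.List using (List; []; _∷_; length)
open import Data.List.Membership.Propositional using (_∈_)
open import Data.List.Relation.Unary.Any using (here; there; index)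
open import Data.List.Membership.Setoid.Properties using (index-injective)
open import Data.List.Relation.Binary.Subset.Propositional using (_⊆_)
open import Data.List.Relation.Unary.Unique.Propositional using (Unique)
open import Data.List.Relation.Unary.All using ([]; _∷_)
open import Data.List.Relation.Unary.AllPairs using ([]; _∷_)
open import Relation.Binary.PropositionalEquality
open import Relation.Nullary using (¬_; yes; no; Dec)

module _ {G : Graph} where
  _++w_ : ∀ {x y z a b} → Walk G x y a → Walk G y z b → Walk G x z (a + b)
  [ _ ] ++w q = q
  (e ∷ p) ++w q = e ∷ (p ++w q)

  onJunction : ∀ {x y z a b} (p : Walk G x y a) (q : Walk G y z b) → OnWalk G y (p ++w q)
  onJunction [ _ ] [ _ ] = here-end
  onJunction [ _ ] (e ∷ q) = here e q
  onJunction (e ∷ p) q = there e (onJunction p q)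

  splitAt : ∀ {x y z k} (w : Walk G x y k) → OnWalk G z w →
            Σ ℕ λ a → Σ ℕ λ b → Walk G x z a × Walk G z y b × a + b ≡ k
  splitAt [ _ ] here-end = 0 , 0 , [ _ ] , [ _ ] , refl
  splitAt (e ∷ p) (here .e .p) = 0 , _ , [ _ ] , e ∷ p , refl
  splitAt (e ∷ p) (there .e o) with splitAt p o
  ... | a , b , w₁ , w₂ , eq = suc a , b , e ∷ w₁ , w₂ , cong suc eq

m+n≤n⇒m≡0 : ∀ m n → m + n ≤ n → m ≡ 0
m+n≤n⇒m≡0 m n le = n≤0⇒n≡0 (≤-trans (m+n≤o⇒m≤o∸n m le) (≤-reflexive (n∸n≡0 n)))

max-sum-bound : ∀ p q r s {M} → (p ⊔ q) + (r ⊔ s) ≤ M →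
                (p + r ≤ M) × (q + s ≤ M) × (q + r ≤ M) × (p + s ≤ M)
max-sum-bound p q r s {M} le =
  bound (m≤m⊔n p q) (m≤m⊔n r s) , bound (m≤n⊔m p q) (m≤n⊔m r s) ,
  bound (m≤n⊔m p q) (m≤m⊔n r s) , bound (m≤m⊔n p q) (m≤n⊔m r s)
  where
    bound : ∀ {x y} → x ≤ p ⊔ q → y ≤ r ⊔ s → x + y ≤ M
    bound x≤ y≤ = ≤-trans (+-mono-≤ x≤ y≤) le

-- Such a
-- function is exactly the shortest-path distance, which lets geodesic
-- intervals be described by the inequality d u z + d z v ≤ d u v.
record Metric (X : Graph) : Set where
  field
    d      : V X → V X → ℕ
    d-eq   : ∀ {x y} → d x y ≡ 0 → x ≡ y
    d-refl : ∀ x → d x x ≡ 0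
    d-sym  : ∀ x y → d x y ≡ d y x
    walk   : ∀ x y → Walk X x y (d x y)
    lip    : ∀ {x x'} y → Adj X x x' → d x y ≤ suc (d x' y)

module MetricFacts {X : Graph} (M : Metric X) where
  open Metric M

  walk-bound : ∀ {x y k} → Walk X x y k → d x y ≤ k
  walk-bound [ x ] = ≤-reflexive (d-refl x)
  walk-bound {y = y} (e ∷ p) = ≤-trans (lip y e) (s≤s (walk-bound p))

  Between : V X → V X → V X → Set
  Between u v z = d u z + d z v ≤ d u v

  between⇒interval : ∀ {u v z} → Between u v z → Interval X u v z
  between⇒interval {u} {v} {z} le =
    _ , walk u z ++w walk z v , (λ j w → ≤-trans le (walk-bound w)) , onJunction (walk u z) (walk z v)

  interval⇒between : ∀ {u v z} → Interval X u v z → Between u v z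
  interval⇒between {u} {v} (k , w , shortest , on) with splitAt w on
  ... | a , b , w₁ , w₂ , a+b≡k =
    ≤-trans (+-mono-≤ (walk-bound w₁) (walk-bound w₂)) (≤-trans (≤-reflexive a+b≡k) (shortest _ (walk u v)))

  dist-pos : ∀ {x y} → x ≢ y → 1 ≤ d x y
  dist-pos {x} {y} x≢y with d x y in eq
  ... | zero = ⊥-elim (x≢y (d-eq eq))
  ... | suc _ = s≤s z≤n

  dist-zeroˡ : ∀ {x y k} → d x y + k ≤ k → x ≡ y
  dist-zeroˡ {x} {y} {k} le = d-eq (m+n≤n⇒m≡0 (d x y) k le)

  dist-zeroʳ : ∀ {x y k} → k + d x y ≤ k → x ≡ y
  dist-zeroʳ {x} {y} {k} le = dist-zeroˡ (subst (_≤ k) (+-comm k (d x y)) le)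

  _≟V_ : (x y : V X) → Dec (x ≡ y)
  x ≟V y with d x y ≟ 0
  ... | yes d≡0 = yes (d-eq d≡0)
  ... | no d≢0 = no (λ { refl → d≢0 (d-refl x) })

  between-self : ∀ {u z} → Between u u z → u ≡ z
  between-self {u} {z} le = d-eq (n≤0⇒n≡0 (≤-trans (m≤m+n (d u z) (d z u)) (≤-trans le (≤-reflexive (d-refl u)))))

  singleton-convex : ∀ s → Convex X (_≡ s)
  singleton-convex s u v z refl refl I = sym (between-self (interval⇒between I))

  -- A single vertex is its own convex hull, so in a graph with two distinct
  -- vertices every hull set has at least two elements.
  hull-lower : ∀ {x y} → x ≢ y → ∀ S → HullSet X S → 2 ≤ length S
  hull-lower {x} x≢y [] hs = ⊥-elim (hs x (λ _ → ⊥) (λ _ _ _ ()) (λ _ ()))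
  hull-lower {x} {y} x≢y (s ∷ []) hs = ⊥-elim (x≢y (trans (hull-is-s x) (sym (hull-is-s y))))
    where
      hull-is-s : ∀ z → z ≡ s
      hull-is-s z = hs z (_≡ s) (singleton-convex s) (λ { _ (here e) → e })
  hull-lower _ (_ ∷ _ ∷ _) _ = s≤s (s≤s z≤n)

  StrictlyBetween : V X → V X → V X → Set
  StrictlyBetween u v z = z ≢ u × z ≢ v × Between u v z

  strictly-between-sym : ∀ {u v z} → StrictlyBetween u v z → StrictlyBetween v u z
  strictly-between-sym {u} {v} {z} (z≢u , z≢v , le) = z≢v , z≢u ,
    subst₂ _≤_ (trans (+-comm (d u z) (d z v)) (cong₂ _+_ (d-sym z v) (d-sym u z))) (d-sym u v) le

  not-strictly-between-equal : ∀ {u v z} → u ≡ v → ¬ StrictlyBetween u v z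
  not-strictly-between-equal refl (z≢u , _ , le) = z≢u (sym (between-self le))

  strictly-between-unique : ∀ {i j k} → StrictlyBetween j k i → StrictlyBetween i k j → ⊥
  strictly-between-unique {i} {j} {k} (_ , _ , j-i-k) (j≢i , _ , i-j-k) = j≢i (sym (dist-zeroˡ d-ij+d-ik≤d-ik))
    where
      d-ij+d-ik≤d-ik : d i j + d i k ≤ d i k
      d-ij+d-ik≤d-ik = ≤-trans (+-monoʳ-≤ (d i j) (≤-trans (m≤n+m (d i k) (d i j))
                         (subst (λ t → t + d i k ≤ d j k) (d-sym j i) j-i-k))) i-j-k

Extreme : {X : Graph} → Metric X → V X → Set
Extreme M c = ∀ a b → Between a b c → a ≡ c ⊎ c ≡ b
  where open MetricFacts M

-- Lazy walks may stay put; they let a short walk in one factor be padded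
-- to the length of a longer walk in the other.
LazyAdj : (X : Graph) → V X → V X → Set
LazyAdj X a b = a ≡ b ⊎ Adj X a b

data LazyWalk (X : Graph) : V X → V X → ℕ → Set where
  [_]' : (x : V X) → LazyWalk X x x zero
  _∷'_ : ∀ {x y z k} → LazyAdj X x y → LazyWalk X y z k → LazyWalk X x z (suc k)

lazy : ∀ {X x y k} → Walk X x y k → LazyWalk X x y k
lazy [ x ] = [ x ]'
lazy (e ∷ p) = inj₂ e ∷' lazy p

pad : ∀ {X x y a b} → a ≤ b → Walk X x y a → LazyWalk X x y b
pad {a = a} {b} a≤b w = subst (LazyWalk _ _ _) (m∸n+n≡m a≤b) (stay (b ∸ a) (lazy w))
  where
    stay : ∀ {X x y k} e → LazyWalk X x y k → LazyWalk X x y (e + k)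
    stay zero p = p
    stay (suc e) p = inj₁ refl ∷' stay e p

module StrongProduct {G H : Graph} (MG : Metric G) (MH : Metric H) where
  private
    module G' = Metric MG
    module H' = Metric MH

  zipˡ : ∀ {g g' h h' k} → Walk G g g' k → LazyWalk H h h' k → Walk (G ⊠ H) (g , h) (g' , h') k
  zipˡ [ g ] [ h ]' = [ (g , h) ]
  zipˡ (e ∷ p) (inj₁ refl ∷' q) = inj₂ (inj₁ (refl , e)) ∷ zipˡ p q
  zipˡ (e ∷ p) (inj₂ f ∷' q) = inj₂ (inj₂ (e , f)) ∷ zipˡ p q

  zipʳ : ∀ {g g' h h' k} → LazyWalk G g g' k → Walk H h h' k → Walk (G ⊠ H) (g , h) (g' , h') k
  zipʳ [ g ]' [ h ] = [ (g , h) ]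
  zipʳ (inj₁ refl ∷' p) (e ∷ q) = inj₁ (refl , e) ∷ zipʳ p q
  zipʳ (inj₂ f ∷' p) (e ∷ q) = inj₂ (inj₂ (f , e)) ∷ zipʳ p q

  dist : V (G ⊠ H) → V (G ⊠ H) → ℕ
  dist (g , h) (g' , h') = G'.d g g' ⊔ H'.d h h'

  dist-walk : ∀ x y → Walk (G ⊠ H) x y (dist x y)
  dist-walk (g , h) (g' , h') with ≤-total (G'.d g g') (H'.d h h')
  ... | inj₁ le = subst (Walk _ _ _) (sym (m≤n⇒m⊔n≡n le)) (zipʳ (pad le (G'.walk g g')) (H'.walk h h'))
  ... | inj₂ le = subst (Walk _ _ _) (sym (m≥n⇒m⊔n≡m le)) (zipˡ (G'.walk g g') (pad le (H'.walk h h')))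

  dist-lip : ∀ {x x'} y → Adj (G ⊠ H) x x' → dist x y ≤ suc (dist x' y)
  dist-lip (g'' , h'') (inj₁ (refl , f)) = ⊔-mono-≤ (n≤1+n _) (H'.lip h'' f)
  dist-lip (g'' , h'') (inj₂ (inj₁ (refl , f))) = ⊔-mono-≤ (G'.lip g'' f) (n≤1+n _)
  dist-lip (g'' , h'') (inj₂ (inj₂ (f , f'))) = ⊔-mono-≤ (G'.lip g'' f) (H'.lip h'' f')

  dist-eq : ∀ {x y} → dist x y ≡ 0 → x ≡ y
  dist-eq {g , h} {g' , h'} eq =
    cong₂ _,_ (G'.d-eq (n≤0⇒n≡0 (≤-trans (m≤m⊔n _ _) (≤-reflexive eq))))
              (H'.d-eq (n≤0⇒n≡0 (≤-trans (m≤n⊔m _ _) (≤-reflexive eq))))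

  metric : Metric (G ⊠ H)
  metric = record
    { d = dist
    ; d-eq = dist-eq
    ; d-refl = λ { (g , h) → cong₂ _⊔_ (G'.d-refl g) (H'.d-refl h) }
    ; d-sym = λ { (g , h) (g' , h') → cong₂ _⊔_ (G'.d-sym g g') (H'.d-sym h h') }
    ; walk = dist-walk
    ; lip = dist-lip
    }

  open MetricFacts metric using () renaming (Between to Between⊠)
  open MetricFacts MG using () renaming (Between to G-Between; dist-zeroˡ to G-zeroˡ; dist-zeroʳ to G-zeroʳ)
  open MetricFacts MH using (StrictlyBetween)
    renaming (Between to H-Between; _≟V_ to _≟H_; dist-zeroˡ to H-zeroˡ; dist-zeroʳ to H-zeroʳ)

  pair-between : ∀ {p c a a' z} → H-Between a a' z → G'.d p c ≤ H'.d a z → G'.d p c ≤ H'.d a' z →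
                 Between⊠ (p , a) (p , a') (c , z)
  pair-between {p} {c} {a} {a'} {z} btw near near' = begin
    (G'.d p c ⊔ H'.d a z) + (G'.d c p ⊔ H'.d z a') ≡⟨ cong₂ _+_ (m≤n⇒m⊔n≡n near) (m≤n⇒m⊔n≡n near-sym) ⟩
    H'.d a z + H'.d z a'                          ≤⟨ btw ⟩
    H'.d a a'                                     ≤⟨ m≤n⊔m (G'.d p p) (H'.d a a') ⟩
    G'.d p p ⊔ H'.d a a'                          ∎
    where
      open ≤-Reasoning
      near-sym : G'.d c p ≤ H'.d z a'
      near-sym = subst₂ _≤_ (G'.d-sym p c) (H'.d-sym a' z) near'

  cross-between : ∀ {p q c i j z} → G-Between p q c → H'.d i z ≤ G'.d p c → H'.d j z ≤ G'.d q c →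
                  Between⊠ (p , i) (q , j) (c , z)
  cross-between {p} {q} {c} {i} {j} {z} btw near near' = begin
    (G'.d p c ⊔ H'.d i z) + (G'.d c q ⊔ H'.d z j) ≡⟨ cong₂ _+_ (m≥n⇒m⊔n≡m near) (m≥n⇒m⊔n≡m near-sym) ⟩
    G'.d p c + G'.d c q                          ≤⟨ btw ⟩
    G'.d p q                                     ≤⟨ m≤m⊔n (G'.d p q) (H'.d i j) ⟩
    G'.d p q ⊔ H'.d i j                          ∎
    where
      open ≤-Reasoning
      near-sym : H'.d z j ≤ G'.d c q
      near-sym = subst₂ _≤_ (H'.d-sym j z) (G'.d-sym q c) near'

  detour : V G → V H → V G → V H → V G → V H → ℕ
  detour a i b j c z = (G'.d a c ⊔ H'.d i z) + (G'.d c b ⊔ H'.d z j)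

  detour-bound : ∀ {a i b j c z M} → detour a i b j c z ≤ M →
    (G'.d a c + G'.d c b ≤ M) × (H'.d i z + H'.d z j ≤ M) × (H'.d i z + G'.d c b ≤ M) × (G'.d a c + H'.d z j ≤ M)
  detour-bound {a} {i} {b} {j} {c} {z} = max-sum-bound (G'.d a c) (H'.d i z) (G'.d c b) (H'.d z j)

  column-G-bound : ∀ {a i b j c z} → Extreme MG c → detour a i b j c z ≤ G'.d a b →
                   (c , z) ≡ (a , i) ⊎ (c , z) ≡ (b , j)
  column-G-bound {a} {i} {b} {j} ext le with detour-bound le
  ... | GG , _ , HG , GH with ext a b GG
  ...   | inj₁ refl = inj₁ (cong (a ,_) (sym (H-zeroˡ HG)))
  ...   | inj₂ refl = inj₂ (cong (b ,_) (H-zeroʳ GH))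

  column-H-bound : ∀ {a i b j c z} → detour a i b j c z ≤ H'.d i j →
                   (c , z) ≡ (a , i) ⊎ (c , z) ≡ (b , j) ⊎ StrictlyBetween i j z
  column-H-bound {i = i} {j = j} {z = z} le with detour-bound le | z ≟H i | z ≟H j
  ... | _ , _ , _ , GH | yes refl | _ = inj₁ (cong (_, z) (sym (G-zeroˡ GH)))
  ... | _ , _ , HG , _ | no _ | yes refl = inj₂ (inj₁ (cong (_, z) (G-zeroʳ HG)))
  ... | _ , HH , _ , _ | no z≢i | no z≢j = inj₂ (inj₂ (z≢i , z≢j , HH))

  extreme-column : ∀ {c} → Extreme MG c → ∀ {a i b j z} → Between⊠ (a , i) (b , j) (c , z) →
                   (c , z) ≡ (a , i) ⊎ (c , z) ≡ (b , j) ⊎ StrictlyBetween i j z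
  extreme-column ext {a} {i} {b} {j} btw with ≤-total (H'.d i j) (G'.d a b)
  ... | inj₁ H≤G with column-G-bound ext (≤-trans btw (≤-reflexive (m≥n⇒m⊔n≡m H≤G)))
  ...   | inj₁ e = inj₁ e
  ...   | inj₂ e = inj₂ (inj₁ e)
  extreme-column ext btw | inj₂ G≤H = column-H-bound (≤-trans btw (≤-reflexive (m≤n⇒m⊔n≡n G≤H)))

-- A list containing k pairwise distinct elements has length at least k:
-- otherwise two of them would sit at the same position (pigeonhole).
distinct-members : ∀ {A : Set} {k} (xs : List A) (f : Fin k → A) →
                   (∀ {i j} → i <F j → f i ≢ f j) → (∀ i → f i ∈ xs) → k ≤ length xs
distinct-members {k = k} xs f distinct mem with k ≤? length xs
... | yes k≤ = k≤
... | no k≰ with pigeonhole (≰⇒> k≰) (λ i → index (mem i))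
...   | i , j , i<j , same = ⊥-elim (distinct i<j (index-injective (setoid _) (mem i) (mem j) same))

module _ {A B : Set} {a a' : A} {b b' : B} (a≢a' : a ≢ a') (b≢b' : b ≢ b') where
  private
    corner : Fin 4 → A × B
    corner fzero = a , b
    corner (fsuc fzero) = a' , b
    corner (fsuc (fsuc fzero)) = a , b'
    corner (fsuc (fsuc (fsuc fzero))) = a' , b'

    corners-distinct : ∀ {i j} → i <F j → corner i ≢ corner j
    corners-distinct {fzero} {fsuc fzero} _ e = a≢a' (cong proj₁ e)
    corners-distinct {fzero} {fsuc (fsuc fzero)} _ e = b≢b' (cong proj₂ e)
    corners-distinct {fzero} {fsuc (fsuc (fsuc fzero))} _ e = a≢a' (cong proj₁ e)
    corners-distinct {fsuc fzero} {fsuc (fsuc fzero)} _ e = a≢a' (sym (cong proj₁ e))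
    corners-distinct {fsuc fzero} {fsuc (fsuc (fsuc fzero))} _ e = b≢b' (cong proj₂ e)
    corners-distinct {fsuc (fsuc fzero)} {fsuc (fsuc (fsuc fzero))} _ e = a≢a' (cong proj₁ e)
    corners-distinct {fsuc fzero} {fsuc fzero} (s≤s ())
    corners-distinct {fsuc (fsuc _)} {fsuc fzero} (s≤s ())
    corners-distinct {fsuc (fsuc _)} {fsuc (fsuc fzero)} (s≤s (s≤s ()))
    corners-distinct {fsuc (fsuc (fsuc _))} {fsuc (fsuc (fsuc fzero))} (s≤s (s≤s (s≤s ())))

  rectangle-length : ∀ {xs} → (a , b) ∈ xs → (a' , b) ∈ xs → (a , b') ∈ xs → (a' , b') ∈ xs → 4 ≤ length xs
  rectangle-length {xs} m₁ m₂ m₃ m₄ = distinct-members xs corner corners-distinct mem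
    where
      mem : ∀ i → corner i ∈ xs
      mem fzero = m₁
      mem (fsuc fzero) = m₂
      mem (fsuc (fsuc fzero)) = m₃
      mem (fsuc (fsuc (fsuc fzero))) = m₄

-- Over an extreme vertex c, a vertex (c , z) outside S is only covered when
-- its height z is strictly between the heights of two members of S.  For a
-- set of at most three vertices at most one of the heights is of this kind,
-- so two heights are "doubled" (both (c₀ , t) and (c₁ , t) lie in S), which
-- already needs four vertices unless all heights coincide.
module GeodeticLowerBound {G H : Graph} (MG : Metric G) (MH : Metric H)
  {c₀ c₁ : V G} (c₀≢c₁ : c₀ ≢ c₁) (ext₀ : Extreme MG c₀) (ext₁ : Extreme MG c₁)
  {t₀ t₁ : V H} (t₀≢t₁ : t₀ ≢ t₁) where
  open StrongProduct MG MH using (metric; extreme-column)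
  open MetricFacts metric using (interval⇒between)
  open MetricFacts MH using (StrictlyBetween; _≟V_; strictly-between-sym;
                             not-strictly-between-equal; strictly-between-unique)

  private
    X : Graph
    X = G ⊠ H

  other : V H → V H
  other t with t ≟V t₀
  ... | yes _ = t₁
  ... | no _ = t₀

  other≢ : ∀ t → other t ≢ t
  other≢ t with t ≟V t₀
  ... | yes refl = λ e → t₀≢t₁ (sym e)
  ... | no t≢t₀ = λ e → t≢t₀ (sym e)

  Inside : List (V X) → V H → Set
  Inside S z = Σ (V X) λ u → Σ (V X) λ v → u ∈ S × v ∈ S × StrictlyBetween (proj₂ u) (proj₂ v) z

  column-covered : ∀ {S c} → Extreme MG c → Geodetic X S → ∀ z → (c , z) ∈ S ⊎ Inside S z
  column-covered ext geo z with geo (_ , z)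
  ... | u , v , u∈S , v∈S , I with extreme-column ext (interval⇒between I)
  ...   | inj₁ refl = inj₁ u∈S
  ...   | inj₂ (inj₁ refl) = inj₁ v∈S
  ...   | inj₂ (inj₂ sb) = inj₂ (u , v , u∈S , v∈S , sb)

  Doubled : List (V X) → V H → Set
  Doubled S t = (c₀ , t) ∈ S × (c₁ , t) ∈ S

  doubled-or-inside : ∀ {S} → Geodetic X S → ∀ t → Doubled S t ⊎ Inside S t
  doubled-or-inside geo t with column-covered ext₀ geo t | column-covered ext₁ geo t
  ... | inj₁ m₀ | inj₁ m₁ = inj₁ (m₀ , m₁)
  ... | inj₂ ins | _ = inj₂ ins
  ... | inj₁ _ | inj₂ ins = inj₂ ins

  doubled-twice : ∀ {S t t'} → Doubled S t → Doubled S t' → t ≢ t' → 4 ≤ length S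
  doubled-twice (m₀ , m₁) (m₀' , m₁') t≢t' = rectangle-length c₀≢c₁ t≢t' m₀ m₁ m₀' m₁'

  -- A set whose vertices all have the same height is not geodetic: the
  -- vertex (c₀ , other t) is neither in it nor Inside it.
  flat-not-geodetic : ∀ {S} t → (∀ {x} → x ∈ S → proj₂ x ≡ t) → ¬ Geodetic X S
  flat-not-geodetic t flat geo with column-covered ext₀ geo (other t)
  ... | inj₁ m = other≢ t (flat m)
  ... | inj₂ (u , v , u∈S , v∈S , sb) = not-strictly-between-equal (trans (flat u∈S) (sym (flat v∈S))) sb

  geodetic-mono : ∀ {S S'} → S ⊆ S' → Geodetic X S → Geodetic X S'
  geodetic-mono sub geo x with geo x
  ... | u , v , u∈S , v∈S , I = u , v , sub u∈S , sub v∈S , I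

  inside-first : ∀ {s₁ s₂ s₃} → Inside (s₁ ∷ s₂ ∷ s₃ ∷ []) (proj₂ s₁) →
                 StrictlyBetween (proj₂ s₂) (proj₂ s₃) (proj₂ s₁)
  inside-first (_ , _ , here refl , _ , z≢u , _) = ⊥-elim (z≢u refl)
  inside-first (_ , _ , _ , here refl , _ , z≢v , _) = ⊥-elim (z≢v refl)
  inside-first (_ , _ , there (here refl) , there (here refl) , sb) = ⊥-elim (not-strictly-between-equal refl sb)
  inside-first (_ , _ , there (here refl) , there (there (here refl)) , sb) = sb
  inside-first (_ , _ , there (there (here refl)) , there (here refl) , sb) = strictly-between-sym sb
  inside-first (_ , _ , there (there (here refl)) , there (there (here refl)) , sb) =
    ⊥-elim (not-strictly-between-equal refl sb)
  inside-first (_ , _ , there (there (there ())) , _)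
  inside-first (_ , _ , _ , there (there (there ())) , _)

  -- Rotating a triple keeps its members, which lets the analysis of the
  -- first height be reused for the other two.
  rotate : ∀ {s₁ s₂ s₃ : V X} → (s₁ ∷ s₂ ∷ s₃ ∷ []) ⊆ (s₂ ∷ s₃ ∷ s₁ ∷ [])
  rotate (here e) = there (there (here e))
  rotate (there (here e)) = here e
  rotate (there (there (here e))) = there (here e)
  rotate (there (there (there ())))

  status : ∀ {S} s₁ s₂ s₃ → S ⊆ (s₁ ∷ s₂ ∷ s₃ ∷ []) → (s₁ ∷ s₂ ∷ s₃ ∷ []) ⊆ S → Geodetic X S →
           Doubled S (proj₂ s₁) ⊎ StrictlyBetween (proj₂ s₂) (proj₂ s₃) (proj₂ s₁)
  status s₁ s₂ s₃ S⊆T T⊆S geo with doubled-or-inside (geodetic-mono S⊆T geo) (proj₂ s₁)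
  ... | inj₁ (m₀ , m₁) = inj₁ (T⊆S m₀ , T⊆S m₁)
  ... | inj₂ ins = inj₂ (inside-first ins)

  same-height : ∀ {s₁ s₂ s₃ t t'} → Doubled (s₁ ∷ s₂ ∷ s₃ ∷ []) t → Doubled (s₁ ∷ s₂ ∷ s₃ ∷ []) t' → t ≡ t'
  same-height {t = t} {t'} d d' with t ≟V t'
  ... | yes t≡t' = t≡t'
  ... | no t≢t' = ⊥-elim (1+n≰n (doubled-twice d d' t≢t'))

  -- Combining the statuses of the three heights: two heights strictly
  -- between the others contradict each other, and two doubled heights are
  -- equal, which leaves no room for the third.
  no-geodetic-triple : ∀ s₁ s₂ s₃ → ¬ Geodetic X (s₁ ∷ s₂ ∷ s₃ ∷ [])
  no-geodetic-triple s₁ s₂ s₃ geo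
    with status s₁ s₂ s₃ (λ m → m) (λ m → m) geo
       | status s₂ s₃ s₁ rotate (λ m → rotate (rotate m)) geo
       | status s₃ s₁ s₂ (λ m → rotate (rotate m)) rotate geo
  ... | inj₂ b₁ | inj₂ b₂ | _ = strictly-between-unique b₁ (strictly-between-sym b₂)
  ... | inj₂ b₁ | inj₁ _ | inj₂ b₃ = strictly-between-unique (strictly-between-sym b₁) b₃
  ... | inj₁ _ | inj₂ b₂ | inj₂ b₃ = strictly-between-unique b₂ (strictly-between-sym b₃)
  ... | inj₁ d₁ | inj₁ d₂ | inj₂ b₃ = not-strictly-between-equal (same-height d₁ d₂) b₃
  ... | inj₁ d₁ | inj₂ b₂ | inj₁ d₃ = not-strictly-between-equal (same-height d₃ d₁) b₂
  ... | inj₂ b₁ | inj₁ d₂ | inj₁ d₃ = not-strictly-between-equal (same-height d₂ d₃) b₁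
  ... | inj₁ d₁ | inj₁ d₂ | inj₁ d₃ = flat-not-geodetic (proj₂ s₁) flat geo
    where
      flat : ∀ {x} → x ∈ (s₁ ∷ s₂ ∷ s₃ ∷ []) → proj₂ x ≡ proj₂ s₁
      flat (here refl) = refl
      flat (there (here refl)) = same-height d₂ d₁
      flat (there (there (here refl))) = same-height d₃ d₁
      flat (there (there (there ())))

  -- Sets of at most two vertices are flat or extend to a triple.
  geodetic-lower : ∀ S → Geodetic X S → 4 ≤ length S
  geodetic-lower [] geo = ⊥-elim (flat-not-geodetic t₀ (λ ()) geo)
  geodetic-lower (s ∷ []) geo = ⊥-elim (flat-not-geodetic (proj₂ s) (λ { (here refl) → refl }) geo)
  geodetic-lower (s₁ ∷ s₂ ∷ []) geo = ⊥-elim (no-geodetic-triple s₁ s₂ s₂ (geodetic-mono repeat geo))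
    where
      repeat : (s₁ ∷ s₂ ∷ []) ⊆ (s₁ ∷ s₂ ∷ s₂ ∷ [])
      repeat (here e) = here e
      repeat (there m) = there (there m)
  geodetic-lower (s₁ ∷ s₂ ∷ s₃ ∷ []) geo = ⊥-elim (no-geodetic-triple s₁ s₂ s₃ geo)
  geodetic-lower (_ ∷ _ ∷ _ ∷ _ ∷ _) _ = s≤s (s≤s (s≤s (s≤s z≤n)))

-- These are the
-- properties of P_m and K_m (m ≥ 2) that the theorem uses.
record Poles {G : Graph} (M : Metric G) : Set where
  field
    c₀ c₁ : V G
    c₀≢c₁ : c₀ ≢ c₁
    ext₀ : Extreme M c₀
    ext₁ : Extreme M c₁
    cover : ∀ c → MetricFacts.Between M c₀ c₁ c ⊎ (Metric.d M c₀ c ≤ 1 × Metric.d M c c₁ ≤ 1)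

module LinearWalks (N : ℕ) (R : Fin N → Fin N → Set)
  (up : ∀ i j → toℕ j ≡ suc (toℕ i) → R i j)
  (down : ∀ i j → toℕ i ≡ suc (toℕ j) → R i j) where
  L : Graph
  L = record { V = Fin N ; Adj = R }

  walk-up : ∀ k (i j : Fin N) → toℕ j ≡ k + toℕ i → Walk L i j k
  walk-up zero i j eq = subst (λ j → Walk L i j 0) (toℕ-injective (sym eq)) [ i ]
  walk-up (suc k) i j eq = up i i⁺ ti⁺ ∷ walk-up k i⁺ j (trans eq (trans (sym (+-suc k (toℕ i))) (cong (k +_) (sym ti⁺))))
    where
      i⁺<N : suc (toℕ i) < N
      i⁺<N = ≤-<-trans (subst (suc (toℕ i) ≤_) (sym eq) (s≤s (m≤n+m (toℕ i) k))) (toℕ<n j)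
      i⁺ : Fin N
      i⁺ = fromℕ< i⁺<N
      ti⁺ : toℕ i⁺ ≡ suc (toℕ i)
      ti⁺ = toℕ-fromℕ< i⁺<N

  walk-down : ∀ k (i j : Fin N) → toℕ i ≡ k + toℕ j → Walk L i j k
  walk-down zero i j eq = subst (λ j → Walk L i j 0) (toℕ-injective eq) [ i ]
  walk-down (suc k) i j eq = down i i⁻ (trans eq (cong suc (sym ti⁻))) ∷ walk-down k i⁻ j ti⁻
    where
      i⁻<N : k + toℕ j < N
      i⁻<N = <⇒≤ (subst (_< N) eq (toℕ<n i))
      i⁻ : Fin N
      i⁻ = fromℕ< i⁻<N
      ti⁻ : toℕ i⁻ ≡ k + toℕ j
      ti⁻ = toℕ-fromℕ< i⁻<N

  walk-direct : ∀ i j → Walk L i j ∣ toℕ i - toℕ j ∣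
  walk-direct i j with ≤-total (toℕ i) (toℕ j)
  ... | inj₁ i≤j = subst (Walk L i j) (sym (m≤n⇒∣m-n∣≡n∸m i≤j)) (walk-up _ i j (sym (m∸n+n≡m i≤j)))
  ... | inj₂ j≤i = subst (Walk L i j) (sym (m≤n⇒∣n-m∣≡n∸m j≤i)) (walk-down _ i j (sym (m∸n+n≡m j≤i)))

∣n-1+n∣≡1 : ∀ n → ∣ n - suc n ∣ ≡ 1
∣n-1+n∣≡1 zero = refl
∣n-1+n∣≡1 (suc n) = ∣n-1+n∣≡1 n

∣-∣-step : ∀ {a a'} b → a' ≡ suc a ⊎ a ≡ suc a' → ∣ a - b ∣ ≤ suc ∣ a' - b ∣
∣-∣-step {a} {a'} b adj = ≤-trans (∣-∣-triangle a a' b) (+-monoˡ-≤ ∣ a' - b ∣ (≤-reflexive (unit adj)))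
  where
    unit : a' ≡ suc a ⊎ a ≡ suc a' → ∣ a - a' ∣ ≡ 1
    unit (inj₁ refl) = ∣n-1+n∣≡1 a
    unit (inj₂ refl) = trans (∣-∣-comm (suc a') a') (∣n-1+n∣≡1 a')

sum≤max⇒zero : ∀ a b → a + b ≤ a ⊔ b → a ≡ 0 ⊎ b ≡ 0
sum≤max⇒zero zero b _ = inj₁ refl
sum≤max⇒zero (suc a) zero _ = inj₂ refl
sum≤max⇒zero (suc a) (suc b) (s≤s le) =
  ⊥-elim (<⇒≱ (≤-<-trans (m⊔n≤m+n a b) (+-monoʳ-< a (n<1+n b))) le)

∣-∣-reflect : ∀ L a b → a ≤ L → b ≤ L → ∣ a - b ∣ ≡ ∣ L ∸ a - L ∸ b ∣
∣-∣-reflect L zero zero _ _ = sym (∣n-n∣≡0 L)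
∣-∣-reflect L zero (suc b) _ b≤ = sym (trans (m≤n⇒∣n-m∣≡n∸m (m∸n≤m L (suc b))) (m∸[m∸n]≡n b≤))
∣-∣-reflect L (suc a) zero a≤ _ = sym (trans (m≤n⇒∣m-n∣≡n∸m (m∸n≤m L (suc a))) (m∸[m∸n]≡n a≤))
∣-∣-reflect (suc L) (suc a) (suc b) (s≤s a≤) (s≤s b≤) = ∣-∣-reflect L a b a≤ b≤

module PathMetric (L : ℕ) where
  private
    P : Graph
    P = pathGraph (suc L)

  dist : Fin (suc L) → Fin (suc L) → ℕ
  dist a b = ∣ toℕ a - toℕ b ∣

  metric : Metric P
  metric = record
    { d = dist
    ; d-eq = λ eq → toℕ-injective (∣m-n∣≡0⇒m≡n eq)
    ; d-refl = λ x → ∣n-n∣≡0 (toℕ x)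
    ; d-sym = λ x y → ∣-∣-comm (toℕ x) (toℕ y)
    ; walk = LinearWalks.walk-direct (suc L) (Adj P) (λ _ _ → inj₁) (λ _ _ → inj₂)
    ; lip = λ y → ∣-∣-step (toℕ y)
    }

  last : Fin (suc L)
  last = fromℕ< (n<1+n L)

  toℕ-last : toℕ last ≡ L
  toℕ-last = toℕ-fromℕ< (n<1+n L)

  ≤L : ∀ (a : Fin (suc L)) → toℕ a ≤ L
  ≤L a = ≤-pred (toℕ<n a)

  dist-last : ∀ a → dist a last ≡ L ∸ toℕ a
  dist-last a = trans (cong (λ t → ∣ toℕ a - t ∣) toℕ-last) (m≤n⇒∣m-n∣≡n∸m (≤L a))

  -- Both ends are extreme: an end between a and b makes the distance sum
  -- bounded by a maximum, so one summand vanishes.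
  extreme-first : Extreme metric fzero
  extreme-first a b le with sum≤max⇒zero (toℕ a) (toℕ b)
    (≤-trans (subst (λ t → t + toℕ b ≤ dist a b) (∣-∣-identityʳ (toℕ a)) le) (∣m-n∣≤m⊔n (toℕ a) (toℕ b)))
  ... | inj₁ a≡0 = inj₁ (toℕ-injective a≡0)
  ... | inj₂ b≡0 = inj₂ (toℕ-injective (sym b≡0))

  at-last : ∀ a → L ∸ toℕ a ≡ 0 → a ≡ last
  at-last a e = toℕ-injective (trans (≤-antisym (≤L a) (m∸n≡0⇒m≤n e)) (sym toℕ-last))

  -- Reflection turns "last is between a and b" into the situation at 0.
  reflected-bound : ∀ a b → dist a last + dist last b ≤ dist a b →
                    (L ∸ toℕ a) + (L ∸ toℕ b) ≤ (L ∸ toℕ a) ⊔ (L ∸ toℕ b)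
  reflected-bound a b le = begin
    (L ∸ toℕ a) + (L ∸ toℕ b)   ≡⟨ sym (cong₂ _+_ (dist-last a) (trans (∣-∣-comm (toℕ last) (toℕ b)) (dist-last b))) ⟩
    dist a last + dist last b   ≤⟨ le ⟩
    dist a b                    ≡⟨ ∣-∣-reflect L (toℕ a) (toℕ b) (≤L a) (≤L b) ⟩
    ∣ L ∸ toℕ a - L ∸ toℕ b ∣   ≤⟨ ∣m-n∣≤m⊔n (L ∸ toℕ a) (L ∸ toℕ b) ⟩
    (L ∸ toℕ a) ⊔ (L ∸ toℕ b)   ∎
    where open ≤-Reasoning

  extreme-last : Extreme metric last
  extreme-last a b le with sum≤max⇒zero (L ∸ toℕ a) (L ∸ toℕ b) (reflected-bound a b le)
  ... | inj₁ e = inj₁ (at-last a e)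
  ... | inj₂ e = inj₂ (sym (at-last b e))

  on-spine : ∀ c → dist fzero c + dist c last ≤ dist fzero last
  on-spine c = ≤-reflexive (begin
    toℕ c + dist c last   ≡⟨ cong (toℕ c +_) (dist-last c) ⟩
    toℕ c + (L ∸ toℕ c)   ≡⟨ m+[n∸m]≡n (≤L c) ⟩
    L                     ≡⟨ sym toℕ-last ⟩
    toℕ last              ∎)
    where open ≡-Reasoning

  poles : 1 ≤ L → Poles metric
  poles 1≤L = record
    { c₀ = fzero ; c₁ = last
    ; c₀≢c₁ = λ e → <-irrefl refl (≤-trans 1≤L (≤-reflexive (trans (sym toℕ-last) (cong toℕ (sym e)))))
    ; ext₀ = extreme-first ; ext₁ = extreme-last
    ; cover = λ c → inj₁ (on-spine c) }

module CompleteMetric (L : ℕ) where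
  private
    K : Graph
    K = completeGraph (suc L)

  dist : Fin (suc L) → Fin (suc L) → ℕ
  dist a b with a ≟F b
  ... | yes _ = 0
  ... | no _ = 1

  dist≤1 : ∀ a b → dist a b ≤ 1
  dist≤1 a b with a ≟F b
  ... | yes _ = z≤n
  ... | no _ = s≤s z≤n

  dist-eq : ∀ {a b} → dist a b ≡ 0 → a ≡ b
  dist-eq {a} {b} eq with a ≟F b
  ... | yes a≡b = a≡b

  dist-refl : ∀ a → dist a a ≡ 0
  dist-refl a with a ≟F a
  ... | yes _ = refl
  ... | no a≢a = ⊥-elim (a≢a refl)

  dist-sym : ∀ a b → dist a b ≡ dist b a
  dist-sym a b with a ≟F b | b ≟F a
  ... | yes _ | yes _ = refl
  ... | no _ | no _ = refl
  ... | yes a≡b | no b≢a = ⊥-elim (b≢a (sym a≡b))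
  ... | no a≢b | yes b≡a = ⊥-elim (a≢b (sym b≡a))

  dist-walk : ∀ a b → Walk K a b (dist a b)
  dist-walk a b with a ≟F b
  ... | yes refl = [ a ]
  ... | no a≢b = a≢b ∷ [ b ]

  metric : Metric K
  metric = record
    { d = dist ; d-eq = dist-eq ; d-refl = dist-refl ; d-sym = dist-sym ; walk = dist-walk
    ; lip = λ {a} y _ → ≤-trans (dist≤1 a y) (s≤s z≤n) }

  extreme : ∀ c → Extreme metric c
  extreme c a b le with a ≟F c | c ≟F b
  ... | yes a≡c | _ = inj₁ a≡c
  ... | no _ | yes c≡b = inj₂ c≡b
  ... | no _ | no _ = ⊥-elim (<-irrefl refl (≤-trans le (dist≤1 a b)))

  poles : 1 ≤ L → Poles metric
  poles 1≤L = record
    { c₀ = fzero ; c₁ = last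
    ; c₀≢c₁ = λ e → <-irrefl refl (≤-trans 1≤L (≤-reflexive (trans (sym (toℕ-fromℕ< (n<1+n L))) (cong toℕ (sym e)))))
    ; ext₀ = extreme fzero ; ext₁ = extreme last
    ; cover = λ c → inj₂ (dist≤1 fzero c , dist≤1 c last) }
    where
      last : Fin (suc L)
      last = fromℕ< (n<1+n L)

module _ {G : Graph} (adj-sym : ∀ {x y} → Adj G x y → Adj G y x) where
  reverse : ∀ {x y k} → Walk G x y k → Walk G y x k
  reverse [ x ] = [ x ]
  reverse {x} (e ∷ p) = subst (Walk G _ x) (+-comm _ 1) (reverse p ++w (adj-sym e ∷ [ x ]))

cyc : ℕ → ℕ → ℕ → ℕ
cyc n a b = ∣ a - b ∣ ⊓ (n ∸ ∣ a - b ∣)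

cyc≤direct : ∀ n a b {p} → ∣ a - b ∣ ≡ p → cyc n a b ≤ p
cyc≤direct n a b eq = ≤-trans (m⊓n≤m _ _) (≤-reflexive eq)

cyc≤around : ∀ n a b {p} → n ∸ ∣ a - b ∣ ≡ p → cyc n a b ≤ p
cyc≤around n a b eq = ≤-trans (m⊓n≤n _ _) (≤-reflexive eq)

∸-step : ∀ n δ δ' → δ' ≤ suc δ → n ∸ δ ≤ suc (n ∸ δ')
∸-step n δ zero _ = ≤-trans (m∸n≤m n δ) (n≤1+n n)
∸-step n zero (suc zero) _ = m≤n+m∸n n 1
∸-step n zero (suc (suc _)) (s≤s ())
∸-step zero (suc δ) (suc δ') _ = z≤n
∸-step (suc n) (suc δ) (suc δ') (s≤s le) = ∸-step n δ δ' le

cyc-step : ∀ n δ δ' → δ ≤ suc δ' → δ' ≤ suc δ → δ ⊓ (n ∸ δ) ≤ suc (δ' ⊓ (n ∸ δ'))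
cyc-step n δ δ' p q = ⊓-glb (≤-trans (m⊓n≤m δ (n ∸ δ)) p) (≤-trans (m⊓n≤n δ (n ∸ δ)) (∸-step n δ δ' q))

-- Length of the way around from a down to 0, across the closing edge to
-- n₁ and down to b.
around-length : ∀ a b n₁ → a ≤ b → b ≤ n₁ → a + suc (n₁ ∸ b) ≡ suc n₁ ∸ (b ∸ a)
around-length zero b n₁ _ b≤ = sym (+-∸-assoc 1 b≤)
around-length (suc a) (suc b) n₁ (s≤s a≤b) b< = begin
  suc a + suc (n₁ ∸ suc b)  ≡⟨ sym (+-suc a (suc (n₁ ∸ suc b))) ⟩
  a + suc (suc (n₁ ∸ suc b)) ≡⟨ cong (λ t → a + suc t) (sym (+-∸-assoc 1 b<)) ⟩
  a + suc (n₁ ∸ b)          ≡⟨ around-length a b n₁ a≤b (<⇒≤ b<) ⟩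
  suc n₁ ∸ (b ∸ a)          ∎
  where open ≡-Reasoning

closing-step₀ : ∀ n₁ Y → Y ≤ n₁ → cyc (suc n₁) 0 Y ≤ suc (cyc (suc n₁) n₁ Y)
closing-step₀ n₁ Y le rewrite m≤n⇒∣n-m∣≡n∸m le =
  ⊓-glb (≤-trans (m⊓n≤n Y (suc n₁ ∸ Y)) (≤-reflexive (+-∸-assoc 1 le)))
        (≤-trans (m⊓n≤m Y _) (≤-trans (≤-reflexive (sym (m∸[m∸n]≡n le)))
           (≤-trans (∸-monoˡ-≤ (n₁ ∸ Y) (n≤1+n n₁)) (n≤1+n _))))

closing-step₁ : ∀ n₁ Y → Y ≤ n₁ → cyc (suc n₁) n₁ Y ≤ suc (cyc (suc n₁) 0 Y)
closing-step₁ n₁ Y le rewrite m≤n⇒∣n-m∣≡n∸m le =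
  ⊓-glb (≤-trans (m⊓n≤n (n₁ ∸ Y) _) (≤-reflexive (trans (+-∸-assoc 1 (m∸n≤m n₁ Y)) (cong suc (m∸[m∸n]≡n le)))))
        (≤-trans (m⊓n≤m _ _) (≤-trans (∸-monoˡ-≤ Y (n≤1+n n₁)) (n≤1+n _)))

module CycleMetric (n₁ : ℕ) where
  private
    n : ℕ
    n = suc n₁
    C : Graph
    C = cycleGraph n

  dist : Fin n → Fin n → ℕ
  dist a b = cyc n (toℕ a) (toℕ b)

  ≤n₁ : ∀ (a : Fin n) → toℕ a ≤ n₁
  ≤n₁ a = ≤-pred (toℕ<n a)

  adj-sym : ∀ {x y} → Adj C x y → Adj C y x
  adj-sym (inj₁ e) = inj₂ (inj₁ e)
  adj-sym (inj₂ (inj₁ e)) = inj₁ e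
  adj-sym (inj₂ (inj₂ (inj₁ e))) = inj₂ (inj₂ (inj₂ e))
  adj-sym (inj₂ (inj₂ (inj₂ e))) = inj₂ (inj₂ (inj₁ e))

  open LinearWalks n (Adj C) (λ _ _ → inj₁) (λ _ _ e → inj₂ (inj₁ e))

  top : Fin n
  top = fromℕ n₁

  toℕ-top : toℕ top ≡ n₁
  toℕ-top = toℕ-fromℕ n₁

  walk-around : ∀ a b → toℕ a ≤ toℕ b → Walk C a b (n ∸ ∣ toℕ a - toℕ b ∣)
  walk-around a b a≤b = subst (Walk C a b) length-eq
    (walk-down (toℕ a) a fzero (sym (+-identityʳ _)) ++w (closing ∷ walk-down (n₁ ∸ toℕ b) top b to-b))
    where
      closing : Adj C fzero top
      closing = inj₂ (inj₂ (inj₁ (refl , toℕ-top)))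
      to-b : toℕ top ≡ (n₁ ∸ toℕ b) + toℕ b
      to-b = trans toℕ-top (sym (m∸n+n≡m (≤n₁ b)))
      length-eq : toℕ a + suc (n₁ ∸ toℕ b) ≡ n ∸ ∣ toℕ a - toℕ b ∣
      length-eq = trans (around-length (toℕ a) (toℕ b) n₁ a≤b (≤n₁ b)) (cong (n ∸_) (sym (m≤n⇒∣m-n∣≡n∸m a≤b)))

  dist-walk : ∀ a b → Walk C a b (dist a b)
  dist-walk a b with ≤-total ∣ toℕ a - toℕ b ∣ (n ∸ ∣ toℕ a - toℕ b ∣)
  ... | inj₁ le = subst (Walk C a b) (sym (m≤n⇒m⊓n≡m le)) (walk-direct a b)
  ... | inj₂ le with ≤-total (toℕ a) (toℕ b)
  ...   | inj₁ a≤b = subst (Walk C a b) (sym (m≥n⇒m⊓n≡n le)) (walk-around a b a≤b)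
  ...   | inj₂ b≤a = subst (Walk C a b) (sym (m≥n⇒m⊓n≡n le))
                       (subst (λ t → Walk C a b (n ∸ t)) (∣-∣-comm (toℕ b) (toℕ a)) (reverse adj-sym (walk-around b a b≤a)))

  dist-lip : ∀ {x x'} y → Adj C x x' → dist x y ≤ suc (dist x' y)
  dist-lip y (inj₁ e) = cyc-step n _ _ (∣-∣-step (toℕ y) (inj₁ e)) (∣-∣-step (toℕ y) (inj₂ e))
  dist-lip y (inj₂ (inj₁ e)) = cyc-step n _ _ (∣-∣-step (toℕ y) (inj₂ e)) (∣-∣-step (toℕ y) (inj₁ e))
  dist-lip y (inj₂ (inj₂ (inj₁ (e₀ , e₁)))) =
    subst₂ (λ p q → cyc n p (toℕ y) ≤ suc (cyc n q (toℕ y))) (sym e₀) (sym e₁) (closing-step₀ n₁ (toℕ y) (≤n₁ y))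
  dist-lip y (inj₂ (inj₂ (inj₂ (e₀ , e₁)))) =
    subst₂ (λ p q → cyc n p (toℕ y) ≤ suc (cyc n q (toℕ y))) (sym e₁) (sym e₀) (closing-step₁ n₁ (toℕ y) (≤n₁ y))

  dist-eq : ∀ {a b} → dist a b ≡ 0 → a ≡ b
  dist-eq {a} {b} eq with ⊓-sel ∣ toℕ a - toℕ b ∣ (n ∸ ∣ toℕ a - toℕ b ∣)
  ... | inj₁ e = toℕ-injective (∣m-n∣≡0⇒m≡n (trans (sym e) eq))
  ... | inj₂ e = ⊥-elim (<-irrefl refl (≤-trans (m∸n≡0⇒m≤n (trans (sym e) eq)) direct≤n₁))
    where
      direct≤n₁ : ∣ toℕ a - toℕ b ∣ ≤ n₁
      direct≤n₁ = ≤-trans (∣m-n∣≤m⊔n (toℕ a) (toℕ b)) (⊔-lub (≤n₁ a) (≤n₁ b))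

  metric : Metric C
  metric = record
    { d = dist
    ; d-eq = dist-eq
    ; d-refl = λ a → cong (λ t → t ⊓ (n ∸ t)) (∣n-n∣≡0 (toℕ a))
    ; d-sym = λ a b → cong (λ t → t ⊓ (n ∸ t)) (∣-∣-comm (toℕ a) (toℕ b))
    ; walk = dist-walk
    ; lip = dist-lip
    }

-- We treat
-- Z = A - x, Z = A + x and Z = A + h + x separately (0 ≤ x ≤ h).
module Antipodal (h : ℕ) where
  private
    sum-bound : ∀ {s t p q} → s ≤ p → t ≤ q → p + q ≡ h → s + t ≤ h
    sum-bound s≤p t≤q eq = ≤-trans (+-mono-≤ s≤p t≤q) (≤-reflexive eq)

    ∣m+n-m∣≡n : ∀ m n → ∣ m + n - m ∣ ≡ n
    ∣m+n-m∣≡n m n = trans (∣-∣-comm (m + n) m) (∣m-m+n∣≡n m n)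

  antipodal-dist : ∀ A → cyc (h + h) A (A + h) ≡ h
  antipodal-dist A = begin
    ∣ A - A + h ∣ ⊓ (h + h ∸ ∣ A - A + h ∣) ≡⟨ cong (λ t → t ⊓ (h + h ∸ t)) (∣m-m+n∣≡n A h) ⟩
    h ⊓ (h + h ∸ h)                       ≡⟨ cong (h ⊓_) (m+n∸n≡m h h) ⟩
    h ⊓ h                                 ≡⟨ ⊓-idem h ⟩
    h                                     ∎
    where open ≡-Reasoning

  before : ∀ Z x → x ≤ h → cyc (h + h) (Z + x) Z + cyc (h + h) Z (Z + x + h) ≤ h
  before Z x x≤h = sum-bound (cyc≤direct (h + h) (Z + x) Z (∣m+n-m∣≡n Z x)) (cyc≤around (h + h) Z (Z + x + h) around)
                             (m+[n∸m]≡n x≤h)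
    where
      around : h + h ∸ ∣ Z - Z + x + h ∣ ≡ h ∸ x
      around = begin
        h + h ∸ ∣ Z - Z + x + h ∣   ≡⟨ cong (λ t → h + h ∸ ∣ Z - t ∣) (+-assoc Z x h) ⟩
        h + h ∸ ∣ Z - Z + (x + h) ∣ ≡⟨ cong (h + h ∸_) (trans (∣m-m+n∣≡n Z (x + h)) (+-comm x h)) ⟩
        h + h ∸ (h + x)             ≡⟨ [m+n]∸[m+o]≡n∸o h h x ⟩
        h ∸ x                       ∎
        where open ≡-Reasoning

  inside : ∀ A x → x ≤ h → cyc (h + h) A (A + x) + cyc (h + h) (A + x) (A + h) ≤ h
  inside A x x≤h = sum-bound (cyc≤direct (h + h) A (A + x) (∣m-m+n∣≡n A x))
                             (cyc≤direct (h + h) (A + x) (A + h) (trans (∣m+n-m+o∣≡∣n-o∣ A x h) (m≤n⇒∣m-n∣≡n∸m x≤h)))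
                             (m+[n∸m]≡n x≤h)

  beyond : ∀ A x → x ≤ h → cyc (h + h) A (A + h + x) + cyc (h + h) (A + h + x) (A + h) ≤ h
  beyond A x x≤h = sum-bound (cyc≤around (h + h) A (A + h + x) around) (cyc≤direct (h + h) (A + h + x) (A + h) (∣m+n-m∣≡n (A + h) x))
                             (m∸n+n≡m x≤h)
    where
      around : h + h ∸ ∣ A - A + h + x ∣ ≡ h ∸ x
      around = begin
        h + h ∸ ∣ A - A + h + x ∣   ≡⟨ cong (λ t → h + h ∸ ∣ A - t ∣) (+-assoc A h x) ⟩
        h + h ∸ ∣ A - A + (h + x) ∣ ≡⟨ cong (h + h ∸_) (∣m-m+n∣≡n A (h + x)) ⟩
        h + h ∸ (h + x)             ≡⟨ [m+n]∸[m+o]≡n∸o h h x ⟩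
        h ∸ x                       ∎
        where open ≡-Reasoning

  antipodal-between : ∀ A Z → A < h → Z < h + h → cyc (h + h) A Z + cyc (h + h) Z (A + h) ≤ h
  antipodal-between A Z A<h Z<2h with ≤-total Z A
  ... | inj₁ Z≤A with m≤n⇒∃[o]m+o≡n Z≤A
  ...   | x , refl = before Z x (≤-trans (m≤n+m x Z) (<⇒≤ A<h))
  antipodal-between A Z A<h Z<2h | inj₂ A≤Z with ≤-total Z (A + h) | m≤n⇒∃[o]m+o≡n A≤Z
  ... | inj₁ Z≤A+h | x , refl = inside A x (+-cancelˡ-≤ A x h Z≤A+h)
  ... | inj₂ A+h≤Z | _ with m≤n⇒∃[o]m+o≡n A+h≤Z
  ...   | x , refl = beyond A x (+-cancelˡ-≤ h x h (≤-trans (+-monoˡ-≤ x (m≤n+m h A)) (<⇒≤ Z<2h)))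

-- Heights
-- 0, h and 1, h + 1 form two antipodal pairs of the cycle, and every height
-- avoids one of the two pairs.  The geodetic set is
--   A = (c₀ , 0), B = (c₀ , h), C = (c₁ , 1), D = (c₁ , h + 1),
-- and {A, B} is a hull set: its hull contains the column over c₀ and
-- spreads along the edges of G to every column.
module EvenCycleProduct (h' : ℕ) {G : Graph} (MG : Metric G) (poles : Poles MG) where
  h : ℕ
  h = suc (suc h')

  private
    n₁ : ℕ
    n₁ = suc h' + h
    X : Graph
    X = G ⊠ cycleGraph (h + h)
    module G' = Metric MG
    module Cyc = CycleMetric n₁

  open Poles poles
  open Antipodal h using (antipodal-dist; antipodal-between)
  open StrongProduct MG Cyc.metric using (metric; pair-between; cross-between)
  open MetricFacts metric using (between⇒interval; hull-lower) renaming (Between to Between⊠)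
  open MetricFacts Cyc.metric using (dist-pos) renaming (Between to C-Between)
  open GeodeticLowerBound MG Cyc.metric c₀≢c₁ ext₀ ext₁ {fzero} {fsuc fzero} (λ ()) using (geodetic-lower)

  dG : V G → V G → ℕ
  dG = G'.d
  dC : Fin (h + h) → Fin (h + h) → ℕ
  dC = Cyc.dist

  h<2h : h < h + h
  h<2h = s≤s (m≤n+m h (suc h'))

  1+h<2h : suc h < h + h
  1+h<2h = s≤s (s≤s (m≤n+m h h'))

  o one hh h1 : Fin (h + h)
  o = fzero
  one = fsuc fzero
  hh = fromℕ< h<2h
  h1 = fromℕ< 1+h<2h

  antipodal : ∀ (a b : Fin (h + h)) → toℕ a < h → toℕ b ≡ toℕ a + h → ∀ z → C-Between a b z
  antipodal a b a<h b≡a+h z =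
    subst (λ t → cyc (h + h) (toℕ a) (toℕ z) + cyc (h + h) (toℕ z) t ≤ cyc (h + h) (toℕ a) t) (sym b≡a+h)
      (≤-trans (antipodal-between (toℕ a) (toℕ z) a<h (toℕ<n z)) (≤-reflexive (sym (antipodal-dist (toℕ a)))))

  antipodal₀ : ∀ z → C-Between o hh z
  antipodal₀ = antipodal o hh (s≤s z≤n) (toℕ-fromℕ< h<2h)

  antipodal₁ : ∀ z → C-Between one h1 z
  antipodal₁ = antipodal one h1 (s≤s (s≤s z≤n)) (toℕ-fromℕ< 1+h<2h)

  fin≢ : ∀ {a b : Fin (h + h)} {i j} → toℕ a ≡ i → toℕ b ≡ j → i ≢ j → a ≢ b
  fin≢ a≡i b≡j i≢j refl = i≢j (trans (sym a≡i) b≡j)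

  o≢hh : o ≢ hh
  o≢hh = fin≢ refl (toℕ-fromℕ< h<2h) (λ ())

  one≢h1 : one ≢ h1
  one≢h1 = fin≢ refl (toℕ-fromℕ< 1+h<2h) (λ ())

  avoid-pair : ∀ z → (o ≢ z × hh ≢ z) ⊎ (one ≢ z × h1 ≢ z)
  avoid-pair z with z ≟F o | z ≟F hh
  ... | yes refl | _ = inj₂ ((λ ()) , fin≢ (toℕ-fromℕ< 1+h<2h) refl (λ ()))
  ... | no _ | yes refl = inj₂ (fin≢ refl (toℕ-fromℕ< h<2h) (λ ()) ,
                                fin≢ (toℕ-fromℕ< 1+h<2h) (toℕ-fromℕ< h<2h) 1+n≢n)
  ... | no z≢o | no z≢hh = inj₁ ((λ e → z≢o (sym e)) , (λ e → z≢hh (sym e)))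

  A B C D : V X
  A = c₀ , o
  B = c₀ , hh
  C = c₁ , one
  D = c₁ , h1

  S₄ : List (V X)
  S₄ = A ∷ B ∷ C ∷ D ∷ []

  S₄-unique : Unique S₄
  S₄-unique = ((λ e → o≢hh (cong proj₂ e)) ∷ poles≢ ∷ poles≢ ∷ [])
            ∷ (poles≢ ∷ poles≢ ∷ [])
            ∷ ((λ e → one≢h1 (cong proj₂ e)) ∷ [])
            ∷ [] ∷ []
    where
      poles≢ : ∀ {i j} → (c₀ , i) ≢ (c₁ , j)
      poles≢ e = c₀≢c₁ (cong proj₁ e)

  near-or-far : ∀ p c a a' z → (dG p c ≤ dC a z × dG p c ≤ dC a' z) ⊎ (dC a z ≤ dG p c ⊎ dC a' z ≤ dG p c)
  near-or-far p c a a' z with dG p c ≤? dC a z | dG p c ≤? dC a' z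
  ... | yes far | yes far' = inj₁ (far , far')
  ... | no near | _ = inj₂ (inj₁ (<⇒≤ (≰⇒> near)))
  ... | yes _ | no near' = inj₂ (inj₂ (<⇒≤ (≰⇒> near')))

  choose : ∀ {p a a' z k} → (p , a) ∈ S₄ → (p , a') ∈ S₄ → dC a z ≤ k ⊎ dC a' z ≤ k →
           Σ (Fin (h + h)) λ t → (p , t) ∈ S₄ × dC t z ≤ k
  choose {a = a} m _ (inj₁ near) = a , m , near
  choose {a' = a'} _ m' (inj₂ near') = a' , m' , near'

  via-pair₀ : ∀ {p c} z → dG p c ≤ dC o z → dG p c ≤ dC hh z → Between⊠ (p , o) (p , hh) (c , z)
  via-pair₀ z = pair-between {a = o} {hh} {z} (antipodal₀ z)

  via-pair₁ : ∀ {p c} z → dG p c ≤ dC one z → dG p c ≤ dC h1 z → Between⊠ (p , one) (p , h1) (c , z)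
  via-pair₁ z = pair-between {a = one} {h1} {z} (antipodal₁ z)

  close-to-both : ∀ {p q c} → dG p c ≤ 1 → dG q c ≤ 1 → ∀ z →
                  Between⊠ (p , o) (p , hh) (c , z) ⊎ Between⊠ (q , one) (q , h1) (c , z)
  close-to-both near near' z with avoid-pair z
  ... | inj₁ (o≢z , hh≢z) = inj₁ (via-pair₀ z (≤-trans near (dist-pos o≢z)) (≤-trans near (dist-pos hh≢z)))
  ... | inj₂ (one≢z , h1≢z) = inj₂ (via-pair₁ z (≤-trans near' (dist-pos one≢z)) (≤-trans near' (dist-pos h1≢z)))

  -- Covering (c , z): near both poles, use the antipodal pair avoided by z;
  -- otherwise use a pair far enough from z, or, if there is none, one vertex
  -- over each pole close to z, joined through c on a c₀–c₁ geodesic.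
  S₄-geodetic : Geodetic X S₄
  S₄-geodetic (c , z) with cover c
  ... | inj₂ (near₀ , near₁) with close-to-both near₀ (subst (_≤ 1) (G'.d-sym c c₁) near₁) z
  ...   | inj₁ btw = A , B , here refl , there (here refl) , between⇒interval btw
  ...   | inj₂ btw = C , D , there (there (here refl)) , there (there (there (here refl))) , between⇒interval btw
  S₄-geodetic (c , z) | inj₁ spine with near-or-far c₀ c o hh z | near-or-far c₁ c one h1 z
  ... | inj₁ (far , far') | _ = A , B , here refl , there (here refl) , between⇒interval (via-pair₀ z far far')
  ... | inj₂ _ | inj₁ (far , far') =
        C , D , there (there (here refl)) , there (there (there (here refl))) , between⇒interval (via-pair₁ z far far')
  ... | inj₂ near₀ | inj₂ near₁
      with choose (here refl) (there (here refl)) near₀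
         | choose (there (there (here refl))) (there (there (there (here refl)))) near₁
  ...   | i , mi , near-i | j , mj , near-j =
        (c₀ , i) , (c₁ , j) , mi , mj , between⇒interval (cross-between {i = i} {j = j} {z = z} spine near-i near-j)

  -- A convex set containing the column over c contains the column over
  -- every neighbour c' of c, since dG c c' ≤ 1.
  spread : ∀ {c c'} → Adj G c c' → (K : V X → Set) → Convex X K → (∀ z → K (c , z)) → ∀ z → K (c' , z)
  spread {c} {c'} e K convex column z with close-to-both step step z
    where
      step : dG c c' ≤ 1
      step = ≤-trans (G'.lip c' e) (≤-reflexive (cong suc (G'.d-refl c')))
  ... | inj₁ btw = convex (c , o) (c , hh) (c' , z) (column o) (column hh) (between⇒interval btw)
  ... | inj₂ btw = convex (c , one) (c , h1) (c' , z) (column one) (column h1) (between⇒interval btw)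

  -- The hull of {A, B} contains the column over c₀ (all of it lies
  -- between A and B) and hence, following a walk from c₀, every column.
  hull-set : HullSet X (A ∷ B ∷ [])
  hull-set (c , z) K convex base = along (G'.walk c₀ c) base-column z
    where
      at-pole : ∀ {k} → dG c₀ c₀ ≤ k
      at-pole = ≤-trans (≤-reflexive (G'.d-refl c₀)) z≤n
      base-column : ∀ z → K (c₀ , z)
      base-column z = convex A B (c₀ , z) (base A (here refl)) (base B (there (here refl)))
        (between⇒interval (via-pair₀ z at-pole at-pole))
      along : ∀ {a c k} → Walk G a c k → (∀ z → K (a , z)) → ∀ z → K (c , z)
      along [ _ ] column = column
      along (e ∷ p) column = along p (spread e K convex column)

  geodetic-number : GeodeticNumber X 4
  geodetic-number = (S₄ , S₄-unique , refl , S₄-geodetic) , λ S _ geo → geodetic-lower S geo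

  hull-number : HullNumber X 2
  hull-number = (A ∷ B ∷ [] , (A≢B ∷ []) ∷ [] ∷ [] , refl , hull-set) , λ S _ hs → hull-lower A≢B S hs
    where
      A≢B : A ≢ B
      A≢B e = o≢hh (cong proj₂ e)

poled : ∀ k G → G ≡ pathGraph (suc (suc k)) ⊎ G ≡ completeGraph (suc (suc k)) → Σ (Metric G) Poles
poled k _ (inj₁ refl) = PathMetric.metric (suc k) , PathMetric.poles (suc k) (s≤s z≤n)
poled k _ (inj₂ refl) = CompleteMetric.metric (suc k) , CompleteMetric.poles (suc k) (s≤s z≤n)

even-halves : ∀ {n} → 4 ≤ n → 2 ∣ n → Σ ℕ λ h' → n ≡ suc (suc h') + suc (suc h')
even-halves 4≤n (divides q refl) = halves q 4≤n
  where
    halves : ∀ q → 4 ≤ q * 2 → Σ ℕ λ h' → q * 2 ≡ suc (suc h') + suc (suc h')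
    halves (suc (suc h')) _ = h' , trans (*-comm (suc (suc h')) 2) (cong (suc (suc h') +_) (+-identityʳ _))
    halves zero ()
    halves (suc zero) (s≤s (s≤s ()))

proposition6 : (n m : ℕ) → 4 ≤ n → 2 ∣ n → 2 ≤ m →
    (G : Graph) → (G ≡ pathGraph m ⊎ G ≡ completeGraph m) →
    GeodeticNumber (G ⊠ cycleGraph n) 4 × HullNumber (G ⊠ cycleGraph n) 2
proposition6 n (suc (suc k)) 4≤n 2∣n (s≤s (s≤s _)) G G-is with even-halves 4≤n 2∣n | poled k G G-is
... | h' , refl | MG , poles = geodetic-number , hull-number
  where open EvenCycleProduct h' MG poles
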